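{- For every graph $G$, $c_{\max}(G)\le \mathrm{tw}(G)+1$, where $c_{\max}(G)$ is the maximum cop number $c(\mathcal{G})$ over all periodic graphs $\mathcal{G}$ with footprint $G$.
   Context: All graphs are finite, undirected and reflexive. A periodic graph with period $p\ge1$ is a sequence $\mathcal{G}=(G_0,\dots,G_{p-1})$ of graphs $G_i=(V,E_i)$ on a common vertex set, extended by $G_{i+p}=G_i$; its footprint is $(V,\bigcup_iE_i)$. Periodic graphs are assumed temporally connected (equivalently, the footprint is connected). Cops and Robber on $\mathcal{G}$ with $k$ cops (perfect information): cops choose starting vertices, then the robber; in each round $t=0,1,\dots$ each cop moves to a vertex of $N_{G_{t\bmod p}}[\text{its position}]$, then the robber likewise; the cops win if a cop ever moves onto the robber's vertex. The cop number $c(\mathcal{G})$ is the least $k$ such that $k$ cops have a winning strategy. $\mathrm{tw}(G)$ is the treewidth of $G$: the minimum over tree decompositions $(T,\{B_x\})$ of $G$ of $\max_x|B_x|-1$. -}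

module Defs where

open import Data.Nat using (ℕ; zero; suc; _≤_; NonZero)
open import Data.Nat.DivMod using (_mod_)
open import Data.Fin using (Fin; toℕ) renaming (suc to fsuc)
open import Data.Fin.Subset using (Subset; _∈_; ∣_∣)
open import Data.Bool using (Bool; T)
open import Data.List using (List; []; _∷_)
open import Data.Product using (Σ; ∃; ∃-syntax; _×_; _,_; proj₁; proj₂)
open import Data.Sum using (_⊎_)
open import Data.Unit using (⊤)
open import Relation.Binary.PropositionalEquality using (_≡_)

record Graph (n : ℕ) : Set where
  field
    adj      : Fin n → Fin n → Bool
    adj-refl : ∀ x → T (adj x x)
    adj-sym  : ∀ x y → T (adj x y) → T (adj y x)

Edge : ∀ {n} → Graph n → Fin n → Fin n → Set
Edge G x y = T (Graph.adj G x y)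

data WalkIn {A : Set} (E : A → A → Set) (P : A → Set) : A → A → Set where
  here : ∀ {x} → P x → WalkIn E P x x
  step : ∀ {x y z} → P x → E x y → WalkIn E P y z → WalkIn E P x z

Connected : ∀ {n} → Graph n → Set
Connected G = ∀ x y → WalkIn (Edge G) (λ _ → ⊤) x y

record PeriodicGraph (n : ℕ) : Set where
  field
    q    : ℕ
    snap : Fin (suc q) → Graph n

  period : ℕ
  period = suc q

  at : ℕ → Graph n
  at t = snap (t mod suc q)

HasFootprint : ∀ {n} → PeriodicGraph n → Graph n → Set
HasFootprint 𝒢 G =
  ∀ x y → (Edge G x y → ∃[ i ] Edge (PeriodicGraph.snap 𝒢 i) x y)
        × (∃[ i ] Edge (PeriodicGraph.snap 𝒢 i) x y → Edge G x y)

Config : ℕ → ℕ → Set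
Config n k = Fin k → Fin n

State : ℕ → ℕ → Set
State n k = Config n k × Fin n

-- histories of past states (most recent first)
History : ℕ → ℕ → Set
History n k = List (State n k)

record CopStrategy {n : ℕ} (𝒢 : PeriodicGraph n) (k : ℕ) : Set where
  field
    start : Config n k
    move  : (t : ℕ) → History n k → (c : Config n k) → (r : Fin n) →
            Σ (Config n k) λ c' → ∀ i → Edge (PeriodicGraph.at 𝒢 t) (c i) (c' i)

record RobberStrategy {n : ℕ} (𝒢 : PeriodicGraph n) (k : ℕ) : Set where
  field
    start : Config n k → Fin n
    move  : (t : ℕ) → History n k → (c : Config n k) → (r : Fin n) →
            (c' : Config n k) →
            Σ (Fin n) λ r' → Edge (PeriodicGraph.at 𝒢 t) r r'

module _ {n k : ℕ} {𝒢 : PeriodicGraph n}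
         (σ : CopStrategy 𝒢 k) (ρ : RobberStrategy 𝒢 k) where

  private
    module σ = CopStrategy σ
    module ρ = RobberStrategy ρ

  -- history before round t and the state at the start of round t
  play : ℕ → History n k × State n k
  play zero = [] , (σ.start , ρ.start σ.start)
  play (suc t) with play t
  ... | h , (c , r) =
    let c' = proj₁ (σ.move t h c r)
        r' = proj₁ (ρ.move t h c r c')
    in ((c , r) ∷ h) , (c' , r')

  CapturedAt : ℕ → Set
  CapturedAt t with play t
  ... | h , (c , r) = ∃[ i ] (proj₁ (σ.move t h c r) i ≡ r)

CopsWin : ∀ {n} → PeriodicGraph n → ℕ → Set
CopsWin 𝒢 k = Σ (CopStrategy 𝒢 k) λ σ → (ρ : RobberStrategy 𝒢 k) → ∃[ t ] CapturedAt σ ρ t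

-- c(𝒢) ≤ m  (c(𝒢) is the least k such that k cops win)
CopNumber≤ : ∀ {n} → PeriodicGraph n → ℕ → Set
CopNumber≤ 𝒢 m = ∃[ k ] (k ≤ m × CopsWin 𝒢 k)

-- A tree on nodes Fin (suc size), encoded by parent pointers: node
-- (fsuc i) has parent (parent i), whose index is ≤ toℕ i (< toℕ (fsuc i)).
record Tree : Set where
  field
    size     : ℕ
    parent   : Fin size → Fin (suc size)
    parent≤  : ∀ i → toℕ (parent i) ≤ toℕ i

  Node : Set
  Node = Fin (suc size)

  TEdge : Node → Node → Set
  TEdge x y = (∃[ i ] (x ≡ fsuc i × y ≡ parent i))
            ⊎ (∃[ i ] (y ≡ fsuc i × x ≡ parent i))

record TreeDecomposition {n : ℕ} (G : Graph n) : Set where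
  field
    tree : Tree
  open Tree tree public
  field
    bag        : Node → Subset n
    cover-v    : ∀ v → ∃[ x ] (v ∈ bag x)
    cover-e    : ∀ u v → Edge G u v → ∃[ x ] (u ∈ bag x × v ∈ bag x)
    subtree-v  : ∀ v x y → v ∈ bag x → v ∈ bag y →
                 WalkIn TEdge (λ z → v ∈ bag z) x y

WidthAtMost : ∀ {n} {G : Graph n} → TreeDecomposition G → ℕ → Set
WidthAtMost D w = ∀ x → ∣ TreeDecomposition.bag D x ∣ ≤ suc w

-- The w + 1 cops play the classical tree-decomposition strategy, slowed down
-- to the timetable of the periodic graph. Call a node y of the decomposition
-- tree confining if the robber is in a bag of the subtree rooted at y but not in
-- the bag of y's parent, while the cops occupy every vertex the two bags share;
-- the root is always confining. Let y be the deepest confining node. Some vertex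
-- of bag y is unoccupied (otherwise the child of y towards the robber would be
-- confining). The free cop closest to an unoccupied vertex of bag y walks along a
-- shortest footprint path towards it, waiting until the timetable offers its
-- next edge. Every footprint edge lies in some bag, so the robber cannot leave
-- the subtree of y without stepping onto an occupied separator vertex. Hence
-- every round either puts the robber on a cop or decreases lexicographically
-- the number of tree nodes numbered after y, the number of unoccupied vertices
-- of bag y, the distance of the chasing cop to its target, and the waiting
-- time for its next edge.

module Submission where

open import Defs
open import Level using (Level)
open import Data.Nat using (ℕ; zero; suc; _+_; _*_; _∸_; _≤_; _<_; z≤n; s≤s; _≤?_)
open import Data.Nat.Properties
  using ( ≤-refl; ≤-reflexive; ≤-trans; <-≤-trans; ≤-<-trans; <⇒≤; <-irrefl; n<1+n; ≰⇒>; m≤n⇒m≤1+n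
        ; m≤n⇒m<n∨m≡n; +-monoˡ-≤; +-identityʳ; +-suc; *-suc; +-comm; +-assoc; ∸-monoʳ-<; ∸-cancelˡ-≡
        ; module ≤-Reasoning )
open import Data.Nat.Induction using (<-wellFounded)
open import Data.Nat.DivMod using (_mod_; _%_; [m+kn]%n≡m%n; m<n⇒m%n≡m; m%n<n)
open import Data.Fin using (Fin; toℕ) renaming (zero to fzero; suc to fsuc)
open import Data.Fin.Properties
  using (toℕ-injective; toℕ<n; toℕ≤pred[n]; toℕ-fromℕ<; suc-injective; 0≢1+n; ¬Fin0; any?; all?)
  renaming (_≟_ to _≟ᶠ_)
open import Data.Fin.Subset using (Subset; _∈_; _∉_; ∣_∣; _-_)
open import Data.Fin.Subset.Properties
  using (_∈?_; x∈p∧x≢y⇒x∈p-y; x∈p⇒∣p-x∣<∣p∣; p⊂q⇒∣p∣<∣q∣)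
open import Data.Maybe using (Maybe; just; nothing; fromMaybe; maybe′; _>>=_)
import Data.Maybe as Maybe
open import Data.List using (_∷_)
open import Data.Vec using (tabulate)
open import Data.Vec.Functional using (updateAt)
open import Data.Vec.Functional.Properties using (updateAt-updates; updateAt-minimal)
open import Data.Vec.Properties using ([]=⇒lookup; lookup⇒[]=; lookup∘tabulate; tabulate-cong)
open import Data.Product using (∃; ∃-syntax; _×_; _,_; proj₁; proj₂)
open import Data.Product.Relation.Binary.Lex.Strict using (×-Lex; ×-wellFounded)
open import Data.Sum using (_⊎_; inj₁; inj₂)
open import Data.Empty using (⊥-elim)
open import Data.Unit using (⊤)
open import Data.Bool using (true)
open import Function using (_∘_; const; Injective; mk⇔)
open import Induction.WellFounded using (WellFounded; Acc; acc)
open import Relation.Unary using (Pred; Decidable)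
open import Relation.Nullary using (¬_; Dec; yes; no; does)
open import Relation.Nullary.Decidable
  using (T?; ¬?; _×-dec_; _⊎-dec_; _→-dec_; map′; dec-true; does-⇔; decidable-stable)
open import Relation.Binary.PropositionalEquality
  using (_≡_; _≢_; refl; sym; trans; cong; subst; subst₂; module ≡-Reasoning)
open import Relation.Binary using (Rel)

Minimal : ∀ {m ℓ} → Pred (Fin m) ℓ → (Fin m → ℕ) → Fin m → Set ℓ
Minimal P f x = P x × (∀ z → P z → f x ≤ f z)

ArgminSpec : ∀ {m ℓ} → Pred (Fin m) ℓ → (Fin m → ℕ) → Maybe (Fin m) → Set ℓ
ArgminSpec P f nothing = ∀ z → ¬ P z
ArgminSpec P f (just x) = Minimal P f x

opaque
  argmin : ∀ {m ℓ} {P : Pred (Fin m) ℓ} → Decidable P → (Fin m → ℕ) → Maybe (Fin m)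
  argmin {zero} P? f = nothing
  argmin {suc m} P? f with P? fzero | argmin (P? ∘ fsuc) (f ∘ fsuc)
  ... | no _ | nothing = nothing
  ... | no _ | just x = just (fsuc x)
  ... | yes _ | nothing = just fzero
  ... | yes _ | just x with f fzero ≤? f (fsuc x)
  ...   | yes _ = just fzero
  ...   | no _ = just (fsuc x)

  argmin-spec : ∀ {m ℓ} {P : Pred (Fin m) ℓ} (P? : Decidable P) f → ArgminSpec P f (argmin P? f)
  argmin-spec {zero} P? f ()
  argmin-spec {suc m} P? f
    with P? fzero | argmin (P? ∘ fsuc) (f ∘ fsuc) | argmin-spec (P? ∘ fsuc) (f ∘ fsuc)
  ... | no ¬p₀ | nothing | none = λ { fzero p → ¬p₀ p ; (fsuc z) p → none z p }
  ... | no ¬p₀ | just x | px , min = px , λ { fzero p → ⊥-elim (¬p₀ p) ; (fsuc z) p → min z p }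
  ... | yes p₀ | nothing | none = p₀ , λ { fzero _ → ≤-refl ; (fsuc z) p → ⊥-elim (none z p) }
  ... | yes p₀ | just x | (px , min) with f fzero ≤? f (fsuc x)
  ...   | yes f₀≤ = p₀ , λ { fzero _ → ≤-refl ; (fsuc z) p → ≤-trans f₀≤ (min z p) }
  ...   | no f₀≰ = px , λ { fzero _ → <⇒≤ (≰⇒> f₀≰) ; (fsuc z) p → min z p }

  argmin-just : ∀ {m ℓ} {P : Pred (Fin m) ℓ} (P? : Decidable P) f → ∃ P →
                ∃[ x ] (argmin P? f ≡ just x × Minimal P f x)
  argmin-just P? f (z , pz) with argmin P? f | argmin-spec P? f
  ... | nothing | none = ⊥-elim (none z pz)
  ... | just x | min = x , refl , min

opaque
  least : ∀ {ℓ} {P : Pred ℕ ℓ} → Decidable P → ℕ → ℕ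
  least P? zero = zero
  least P? (suc b) with P? zero
  ... | yes _ = zero
  ... | no _ = suc (least (P? ∘ suc) b)

  least-satisfies : ∀ {ℓ} {P : Pred ℕ ℓ} (P? : Decidable P) {j} b →
                    j ≤ b → P j → P (least P? b)
  least-satisfies P? zero z≤n pj = pj
  least-satisfies P? (suc b) j≤b pj with P? zero
  ... | yes p₀ = p₀
  least-satisfies P? (suc b) z≤n pj | no ¬p₀ = ⊥-elim (¬p₀ pj)
  least-satisfies P? (suc b) (s≤s j≤b) pj | no _ = least-satisfies (P? ∘ suc) b j≤b pj

  least-≤ : ∀ {ℓ} {P : Pred ℕ ℓ} (P? : Decidable P) b {j} → P j → least P? b ≤ j
  least-≤ P? zero pj = z≤n
  least-≤ P? (suc b) pj with P? zero
  ... | yes _ = z≤n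
  least-≤ P? (suc b) {zero} pj | no ¬p₀ = ⊥-elim (¬p₀ pj)
  least-≤ P? (suc b) {suc j} pj | no _ = s≤s (least-≤ (P? ∘ suc) b pj)

⟦_⟧ : ∀ {m ℓ} {P : Pred (Fin m) ℓ} → Decidable P → Subset m
⟦ P? ⟧ = tabulate (does ∘ P?)

module _ {m ℓ} {P : Pred (Fin m) ℓ} (P? : Decidable P) where

  ∈⟦⟧⁺ : ∀ {x} → P x → x ∈ ⟦ P? ⟧
  ∈⟦⟧⁺ {x} px = lookup⇒[]= x ⟦ P? ⟧ (trans (lookup∘tabulate _ x) (dec-true (P? x) px))

  ∈⟦⟧⁻ : ∀ {x} → x ∈ ⟦ P? ⟧ → P x
  ∈⟦⟧⁻ {x} x∈ = witness (P? x) (trans (sym (lookup∘tabulate _ x)) ([]=⇒lookup x∈))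
    where
    witness : (d : Dec (P x)) → does d ≡ true → P x
    witness (yes px) _ = px

module _ {m ℓ} {P Q : Pred (Fin m) ℓ} (P? : Decidable P) (Q? : Decidable Q) where

  ⟦⟧-cong : (∀ {x} → P x → Q x) → (∀ {x} → Q x → P x) → ⟦ P? ⟧ ≡ ⟦ Q? ⟧
  ⟦⟧-cong P⇒Q Q⇒P = tabulate-cong λ x → does-⇔ (mk⇔ P⇒Q Q⇒P) (P? x) (Q? x)

  ∣⟦⟧∣-< : (∀ {x} → P x → Q x) → ∀ {a} → Q a → ¬ P a → ∣ ⟦ P? ⟧ ∣ < ∣ ⟦ Q? ⟧ ∣
  ∣⟦⟧∣-< P⇒Q {a} qa ¬pa =
    p⊂q⇒∣p∣<∣q∣ ((∈⟦⟧⁺ Q? ∘ P⇒Q ∘ ∈⟦⟧⁻ P?) , a , ∈⟦⟧⁺ Q? qa , ¬pa ∘ ∈⟦⟧⁻ P?)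

injective⇒≤∣p∣ : ∀ {k m} {p : Subset m} (f : Fin k → Fin m) →
                 Injective _≡_ _≡_ f → (∀ i → f i ∈ p) → k ≤ ∣ p ∣
injective⇒≤∣p∣ {zero} f inj f∈p = z≤n
injective⇒≤∣p∣ {suc k} {p = p} f inj f∈p =
  ≤-trans (s≤s (injective⇒≤∣p∣ (f ∘ fsuc) (suc-injective ∘ inj) f∘suc∈p-f₀))
          (x∈p⇒∣p-x∣<∣p∣ (f∈p fzero))
  where
  f∘suc∈p-f₀ : ∀ i → f (fsuc i) ∈ p - f fzero
  f∘suc∈p-f₀ i = x∈p∧x≢y⇒x∈p-y (f∈p (fsuc i)) (0≢1+n ∘ sym ∘ inj)

module _ {a r ℓ : Level} {A : Set a} {_≺_ : Rel A r} (wf : WellFounded _≺_) where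

  eventually-by-descent : {Q : Set ℓ} (f : ℕ → A) → (∀ t → Q ⊎ f (suc t) ≺ f t) → Q
  eventually-by-descent {Q} f descends = go 0 (wf (f 0))
    where
    go : ∀ t → Acc _≺_ (f t) → Q
    go t (acc rs) with descends t
    ... | inj₁ q = q
    ... | inj₂ f≺ = go (suc t) (rs f≺)

ℕ⁴ : Set
ℕ⁴ = ℕ × ℕ × ℕ × ℕ

_<ₗₑₓ_ : Rel ℕ⁴ _
_<ₗₑₓ_ = ×-Lex _≡_ _<_ (×-Lex _≡_ _<_ (×-Lex _≡_ _<_ _<_))

<ₗₑₓ-wellFounded : WellFounded _<ₗₑₓ_
<ₗₑₓ-wellFounded =
  ×-wellFounded <-wellFounded
    (×-wellFounded <-wellFounded (×-wellFounded <-wellFounded <-wellFounded))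

walk-head : ∀ {A : Set} {E : Rel A _} {P : Pred A _} {x y} → WalkIn E P x y → P x
walk-head (here px) = px
walk-head (step px _ _) = px

walk-length : ∀ {A : Set} {E : Rel A _} {P : Pred A _} {x y} → WalkIn E P x y → ℕ
walk-length (here _) = 0
walk-length (step _ _ w) = suc (walk-length w)

module Rooted (τ : Tree) where
  open Tree τ

  root : Node
  root = fzero

  data _≼_ (y : Node) : Node → Set where
    ≼-refl  : y ≼ y
    ≼-below : ∀ {i} → y ≼ parent i → y ≼ fsuc i

  nodes-after : Node → ℕ
  nodes-after y = size ∸ toℕ y

  nodes-after-injective : ∀ {y y'} → nodes-after y ≡ nodes-after y' → y ≡ y'
  nodes-after-injective {y} {y'} =
    toℕ-injective ∘ ∸-cancelˡ-≡ (toℕ≤pred[n] y) (toℕ≤pred[n] y')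

  nodes-after-child< : ∀ j → nodes-after (fsuc j) < nodes-after (parent j)
  nodes-after-child< j = ∸-monoʳ-< (s≤s (parent≤ j)) (toℕ≤pred[n] (fsuc j))

  ≼⇒≤ : ∀ {y a} → y ≼ a → toℕ y ≤ toℕ a
  ≼⇒≤ ≼-refl = ≤-refl
  ≼⇒≤ (≼-below {i} y≼p) = ≤-trans (≼⇒≤ y≼p) (m≤n⇒m≤1+n (parent≤ i))

  child⋠parent : ∀ j → ¬ fsuc j ≼ parent j
  child⋠parent j j≼p = <-irrefl refl (≤-trans (s≤s (parent≤ j)) (≼⇒≤ j≼p))

  ≼-parent : ∀ {y i} → y ≼ fsuc i → fsuc i ≢ y → y ≼ parent i
  ≼-parent ≼-refl i≢y = ⊥-elim (i≢y refl)
  ≼-parent (≼-below y≼p) _ = y≼p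

  root≼ : ∀ a → root ≼ a
  root≼ a = go a (<-wellFounded (toℕ a))
    where
    go : ∀ a → Acc _<_ (toℕ a) → root ≼ a
    go fzero _ = ≼-refl
    go (fsuc i) (acc rs) = ≼-below (go (parent i) (rs (s≤s (parent≤ i))))

  _≼?_ : ∀ y a → Dec (y ≼ a)
  y ≼? a = decide a (<-wellFounded (toℕ a))
    where
    decide : ∀ a → Acc _<_ (toℕ a) → Dec (y ≼ a)
    decide a _ with a ≟ᶠ y
    ... | yes refl = yes ≼-refl
    decide fzero _ | no a≢y = no λ { ≼-refl → a≢y refl }
    decide (fsuc i) (acc rs) | no a≢y =
      map′ ≼-below (λ y≼a → ≼-parent y≼a a≢y) (decide (parent i) (rs (s≤s (parent≤ i))))

  ≼⇒child : ∀ {y a} → y ≼ a → a ≢ y → ∃[ j ] (parent j ≡ y × fsuc j ≼ a)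
  ≼⇒child ≼-refl a≢y = ⊥-elim (a≢y refl)
  ≼⇒child {y} (≼-below {i} y≼p) _ with parent i ≟ᶠ y
  ... | yes p≡y = i , p≡y , ≼-refl
  ... | no p≢y with ≼⇒child y≼p p≢y
  ...   | j , pj≡y , j≼p = j , pj≡y , ≼-below j≼p

  leaving-subtree : ∀ {P : Pred Node _} {a b} j → WalkIn TEdge P a b →
                    fsuc j ≼ a → ¬ fsuc j ≼ b → P (fsuc j) × P (parent j)
  leaving-subtree j (here _) j≼a j⋠b = ⊥-elim (j⋠b j≼a)
  leaving-subtree j (step {y = x'} px e rest) j≼x j⋠b with fsuc j ≼? x'
  ... | yes j≼x' = leaving-subtree j rest j≼x' j⋠b
  ... | no j⋠x' with e
  ...   | inj₂ (i , refl , refl) = ⊥-elim (j⋠x' (≼-below j≼x))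
  ...   | inj₁ (i , refl , refl) with i ≟ᶠ j
  ...     | yes refl = px , walk-head rest
  ...     | no i≢j = ⊥-elim (j⋠x' (≼-parent j≼x (i≢j ∘ suc-injective)))

module Distance {n} (G : Graph n) (connected : Connected G) where

  Near : ℕ → Fin n → Fin n → Set
  Near zero v u = u ≡ v
  Near (suc d) v u = ∃[ u' ] (Edge G u u' × Near d v u')

  near? : ∀ d v u → Dec (Near d v u)
  near? zero v u = u ≟ᶠ v
  near? (suc d) v u = any? λ u' → T? (Graph.adj G u u') ×-dec near? d v u'

  walk-near : ∀ {u v} (w : WalkIn (Edge G) (λ _ → ⊤) u v) → Near (walk-length w) v u
  walk-near (here _) = refl
  walk-near (step _ e w) = _ , e , walk-near w

  opaque
    dist : Fin n → Fin n → ℕ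
    dist v u = least (λ d → near? d v u) (walk-length (connected u v))

    near-dist : ∀ v u → Near (dist v u) v u
    near-dist v u =
      least-satisfies (λ d → near? d v u) (walk-length (connected u v)) ≤-refl (walk-near (connected u v))

    dist-minimal : ∀ {d v u} → Near d v u → dist v u ≤ d
    dist-minimal {v = v} {u} = least-≤ (λ d → near? d v u) (walk-length (connected u v))

  dist≡0⇒≡ : ∀ {v u} → dist v u ≡ 0 → u ≡ v
  dist≡0⇒≡ {v} {u} eq = subst (λ d → Near d v u) eq (near-dist v u)

  first-step : ∀ {d v u} → Near d v u → Fin n
  first-step {zero} {u = u} _ = u
  first-step {suc d} (u' , _) = u'

  towards : Fin n → Fin n → Fin n
  towards v u = first-step (near-dist v u)

  towards-closer : ∀ {v u d} → dist v u ≡ suc d →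
                   Edge G u (towards v u) × dist v (towards v u) ≤ d
  towards-closer {v} {u} = first-step-closer (near-dist v u)
    where
    first-step-closer : ∀ {e d} (near : Near e v u) → e ≡ suc d →
                        Edge G u (first-step near) × dist v (first-step near) ≤ d
    first-step-closer {suc e} (_ , edge , near) refl = edge , dist-minimal near

module Recurrence {n} (𝒢 : PeriodicGraph n) where
  open PeriodicGraph 𝒢

  EdgeAt : Fin n → Fin n → Pred ℕ _
  EdgeAt u u' t = Edge (at t) u u'

  edgeAt? : ∀ u u' → Decidable (EdgeAt u u')
  edgeAt? u u' t = T? (Graph.adj (at t) u u')

  snap-recurs : ∀ t i → at (t + (toℕ i + t * q)) ≡ snap i
  snap-recurs t i = cong snap (toℕ-injective (begin
    toℕ ((t + (toℕ i + t * q)) mod period) ≡⟨ toℕ-fromℕ< (m%n<n (t + (toℕ i + t * q)) period) ⟩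
    (t + (toℕ i + t * q)) % period          ≡⟨ cong (_% period) rearrange ⟩
    (toℕ i + t * period) % period           ≡⟨ [m+kn]%n≡m%n (toℕ i) t period ⟩
    toℕ i % period                          ≡⟨ m<n⇒m%n≡m (toℕ<n i) ⟩
    toℕ i                                   ∎))
    where
    open ≡-Reasoning
    rearrange : t + (toℕ i + t * q) ≡ toℕ i + t * period
    rearrange = begin
      t + (toℕ i + t * q) ≡⟨ sym (+-assoc t (toℕ i) _) ⟩
      t + toℕ i + t * q   ≡⟨ cong (_+ t * q) (+-comm t (toℕ i)) ⟩
      toℕ i + t + t * q   ≡⟨ +-assoc (toℕ i) t _ ⟩
      toℕ i + (t + t * q) ≡⟨ cong (toℕ i +_) (sym (*-suc t q)) ⟩
      toℕ i + t * period  ∎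

  -- By snap-recurs, every snapshot occurs within period + t * q rounds of round t.
  opaque
    next-appearance : ℕ → Fin n → Fin n → ℕ
    next-appearance t u u' = least (edgeAt? u u' ∘ (t +_)) (period + t * q)

    appears-at-next : ∀ t {u u' i} → Edge (snap i) u u' → EdgeAt u u' (t + next-appearance t u u')
    appears-at-next t {u} {u'} {i} e =
      least-satisfies (edgeAt? u u' ∘ (t +_)) _ (+-monoˡ-≤ (t * q) (<⇒≤ (toℕ<n i)))
                      (subst (λ G → Edge G u u') (sym (snap-recurs t i)) e)

    next-appearance-suc : ∀ t {u u' i} → Edge (snap i) u u' → ¬ EdgeAt u u' t →
                          next-appearance (suc t) u u' < next-appearance t u u'
    next-appearance-suc t {u} {u'} e ¬now with next-appearance t u u' | appears-at-next t e
    ... | zero | now = ⊥-elim (¬now (subst (EdgeAt u u') (+-identityʳ t) now))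
    ... | suc d | later =
      s≤s (least-≤ (edgeAt? u u' ∘ (suc t +_)) _ (subst (EdgeAt u u') (+-suc t d) later))

Occupied : ∀ {n k} → Config n k → Fin n → Set
Occupied c v = ∃[ i ] c i ≡ v

occupied? : ∀ {n k} (c : Config n k) v → Dec (Occupied c v)
occupied? c v = any? λ i → c i ≟ᶠ v

module _ {n k} {𝒢 : PeriodicGraph n} (σ : CopStrategy 𝒢 k) where
  open CopStrategy σ
  open PeriodicGraph 𝒢 using (at)

  cops-after : ℕ → History n k → Config n k → Fin n → Config n k
  cops-after t h c r = proj₁ (move t h c r)

  wins-by-descent : ∀ {A : Set} {ℓ} {_≺_ : Rel A ℓ} → WellFounded _≺_ →
    (μ : ℕ → Config n k → Fin n → A) →
    (∀ t h c r → Occupied c r → Occupied (cops-after t h c r) r) →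
    (∀ t h c r r' → ¬ Occupied c r → Edge (at t) r r' →
       Occupied (cops-after t h c r) r' ⊎ μ (suc t) (cops-after t h c r) r' ≺ μ t c r) →
    (ρ : RobberStrategy 𝒢 k) → ∃[ t ] CapturedAt σ ρ t
  wins-by-descent {A} {_≺_ = _≺_} wf μ capture progress ρ =
    eventually-by-descent wf (λ t → μ-at t (play σ ρ t)) (λ t → round t (play σ ρ t) refl)
    where
    open RobberStrategy ρ renaming (move to robber-move)

    μ-at : ℕ → History n k × State n k → A
    μ-at t (_ , c , r) = μ t c r

    play-suc : ∀ {t h c r} → play σ ρ t ≡ (h , c , r) →
               let c' = cops-after t h c r in
               play σ ρ (suc t) ≡ ((c , r) ∷ h , c' , proj₁ (robber-move t h c r c'))
    play-suc eq rewrite eq = refl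

    captured : ∀ {t h c r} → play σ ρ t ≡ (h , c , r) →
               Occupied (cops-after t h c r) r → CapturedAt σ ρ t
    captured eq occ rewrite eq = occ

    round : ∀ t s → play σ ρ t ≡ s →
            ∃ (CapturedAt σ ρ) ⊎ μ-at (suc t) (play σ ρ (suc t)) ≺ μ-at t (play σ ρ t)
    round t (h , c , r) eq with occupied? c r
    ... | yes occ = inj₁ (t , captured eq (capture t h c r occ))
    ... | no ¬occ with progress t h c r _ ¬occ (proj₂ (robber-move t h c r (cops-after t h c r)))
    ...   | inj₁ occ' = inj₁ (suc t , captured (play-suc eq) (capture (suc t) _ _ _ occ'))
    ...   | inj₂ μ≺ =
      inj₂ (subst₂ _≺_ (cong (μ-at (suc t)) (sym (play-suc eq))) (cong (μ-at t) (sym eq)) μ≺)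

module Chase {n} (G : Graph n) (connected : Connected G) (D : TreeDecomposition G)
             (w : ℕ) (narrow : WidthAtMost D w)
             (𝒢 : PeriodicGraph n) (footprint : HasFootprint 𝒢 G) where
  open TreeDecomposition D
  open Rooted tree
  open Distance G connected
  open Recurrence 𝒢
  open PeriodicGraph 𝒢 using (at)

  Cops : Set
  Cops = Config n (suc w)

  Below : Fin n → Node → Set
  Below r y = ∃[ a ] (y ≼ a × r ∈ bag a)

  Sealed : Cops → Fin n → Node → Set
  Sealed c r fzero = ⊤
  Sealed c r (fsuc j) =
    (∀ v → v ∈ bag (parent j) → v ∈ bag (fsuc j) → Occupied c v) × r ∉ bag (parent j)

  Confined : Cops → Fin n → Node → Set
  Confined c r y = Below r y × Sealed c r y

  confined? : ∀ c r y → Dec (Confined c r y)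
  confined? c r y = below? ×-dec sealed? y
    where
    below? : Dec (Below r y)
    below? = any? λ a → y ≼? a ×-dec r ∈? bag a
    sealed? : ∀ y → Dec (Sealed c r y)
    sealed? fzero = yes _
    sealed? (fsuc j) =
      all? (λ v → v ∈? bag (parent j) →-dec v ∈? bag (fsuc j) →-dec occupied? c v)
      ×-dec ¬? (r ∈? bag (parent j))

  below-root : ∀ r → Below r root
  below-root r = let a , r∈a = cover-v r in a , root≼ a , r∈a

  footprint-edge : ∀ {t u u'} → Edge (at t) u u' → Edge G u u'
  footprint-edge e = proj₂ (footprint _ _) (_ , e)

  confinement-persists : ∀ {c c' r r' y} → Confined c r y →
                         (∀ {v} → v ∈ bag y → Occupied c v → Occupied c' v) → Edge G r r' →
                         Occupied c' r' ⊎ Confined c' r' y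
  confinement-persists {r' = r'} {fzero} _ _ _ = inj₂ (below-root r' , _)
  confinement-persists {c} {c'} {r} {r'} {fsuc j} ((a , j≼a , r∈a) , sealed , r∉p) keeps e
    with cover-e r r' e
  ... | b , r∈b , r'∈b with fsuc j ≼? b
  ...   | no j⋠b = ⊥-elim (r∉p (proj₂ (leaving-subtree j (subtree-v r a b r∈a r∈b) j≼a j⋠b)))
  ...   | yes j≼b with r' ∈? bag (parent j)
  ...     | yes r'∈p = inj₁ (keeps r'∈j (sealed r' r'∈p r'∈j))
    where
    r'∈j : r' ∈ bag (fsuc j)
    r'∈j = proj₁ (leaving-subtree j (subtree-v r' b (parent j) r'∈b r'∈p) j≼b (child⋠parent j))
  ...     | no r'∉p =
    inj₂ ((b , j≼b , r'∈b) , (λ v v∈p v∈j → keeps v∈j (sealed v v∈p v∈j)) , r'∉p)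

  -- Parents precede their children, so a confining node minimising nodes-after
  -- has no confining child.
  opaque
    target : Cops → Fin n → Node
    target c r = fromMaybe root (argmin (confined? c r) nodes-after)

    target-deepest : ∀ c r → Minimal (Confined c r) nodes-after (target c r)
    target-deepest c r with argmin-just (confined? c r) nodes-after (root , below-root r , _)
    ... | y , eq , deepest rewrite eq = deepest

  Unoccupied : Cops → Node → Fin n → Set
  Unoccupied c y v = v ∈ bag y × ¬ Occupied c v

  unoccupied? : ∀ c y → Decidable (Unoccupied c y)
  unoccupied? c y v = v ∈? bag y ×-dec ¬? (occupied? c v)

  target-has-gap : ∀ {c r} → ¬ Occupied c r → ∃ (Unoccupied c (target c r))
  target-has-gap {c} {r} ¬occ with any? (unoccupied? c (target c r)) | target-deepest c r
  ... | yes gap | _ = gap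
  ... | no ¬gap | ((a , y≼a , r∈a) , _) , deepest =
    let j , pj≡y , j≼a = ≼⇒child y≼a a≢y
    in ⊥-elim (<-irrefl refl (<-≤-trans (deeper pj≡y) (deepest (fsuc j) (confined pj≡y j≼a))))
    where
    y = target c r
    full : ∀ {v} → v ∈ bag y → Occupied c v
    full {v} v∈y = decidable-stable (occupied? c v) λ ¬o → ¬gap (v , v∈y , ¬o)
    a≢y : a ≢ y
    a≢y refl = ¬occ (full r∈a)
    confined : ∀ {j} → parent j ≡ y → fsuc j ≼ a → Confined c r (fsuc j)
    confined pj≡y j≼a = (a , j≼a , r∈a) ,
                        (λ v v∈p _ → full (subst (λ x → v ∈ bag x) pj≡y v∈p)) ,
                        (λ r∈p → ¬occ (full (subst (λ x → r ∈ bag x) pj≡y r∈p)))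
    deeper : ∀ {j} → parent j ≡ y → nodes-after (fsuc j) < nodes-after y
    deeper {j} pj≡y =
      subst (λ x → nodes-after (fsuc j) < nodes-after x) pj≡y (nodes-after-child< j)

  Free : Cops → Node → Fin (suc w) → Set
  Free c y i = c i ∉ bag y ⊎ ∃[ j ] (j ≢ i × c j ≡ c i)

  free? : ∀ c y → Decidable (Free c y)
  free? c y i = ¬? (c i ∈? bag y) ⊎-dec any? (λ j → ¬? (j ≟ᶠ i) ×-dec c j ≟ᶠ c i)

  free-cop-exists : ∀ {c y v} → Unoccupied c y v → ∃ (Free c y)
  free-cop-exists {c} {y} {v} (v∈y , ¬occ) with any? (free? c y)
  ... | yes free = free
  ... | no ¬free =
    ⊥-elim (<-irrefl refl (≤-<-trans cops≤ (<-≤-trans (x∈p⇒∣p-x∣<∣p∣ v∈y) (narrow y))))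
    where
    injective : Injective _≡_ _≡_ c
    injective {i} {j} ci≡cj with i ≟ᶠ j
    ... | yes i≡j = i≡j
    ... | no i≢j = ⊥-elim (¬free (j , inj₂ (i , i≢j , ci≡cj)))
    in-bag : ∀ i → c i ∈ bag y - v
    in-bag i = x∈p∧x≢y⇒x∈p-y
      (decidable-stable (c i ∈? bag y) (λ ci∉y → ¬free (i , inj₁ ci∉y))) (λ ci≡v → ¬occ (i , ci≡v))
    cops≤ : suc w ≤ ∣ bag y - v ∣
    cops≤ = injective⇒≤∣p∣ c injective in-bag

  record Pursuit (c : Cops) (y : Node) (i : Fin (suc w)) (v : Fin n) : Set where
    field
      free    : Free c y i
      gap     : Unoccupied c y v
      closest : ∀ {j v'} → Free c y j → Unoccupied c y v' → dist v (c i) ≤ dist v' (c j)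

  opaque
    gap-for : Cops → Node → Fin (suc w) → Maybe (Fin n)
    gap-for c y i = argmin (unoccupied? c y) (λ v → dist v (c i))

    gap-distance : Cops → Node → Fin (suc w) → ℕ
    gap-distance c y i = maybe′ (λ v → dist v (c i)) 0 (gap-for c y i)

    gap-distance-≤ : ∀ {c y v} i → Unoccupied c y v → gap-distance c y i ≤ dist v (c i)
    gap-distance-≤ {c} {y} {v} i gap
      with argmin-just (unoccupied? c y) (λ v → dist v (c i)) (v , gap)
    ... | _ , eq , (_ , closest) rewrite eq = closest v gap

    chase : Cops → Node → Maybe (Fin (suc w) × Fin n)
    chase c y = argmin (free? c y) (gap-distance c y) >>= λ i → Maybe.map (i ,_) (gap-for c y i)

    chase-pursues : ∀ {c y v₀} → Unoccupied c y v₀ →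
                    ∃[ i ] ∃[ v ] (chase c y ≡ just (i , v) × Pursuit c y i v)
    chase-pursues {c} {y} {v₀} gap₀
      with argmin-just (free? c y) (gap-distance c y) (free-cop-exists gap₀)
    ... | i , eqᵢ , free , closest-cop
      with argmin-just (unoccupied? c y) (λ v → dist v (c i)) (v₀ , gap₀)
    ... | v , eqᵥ , gap , _ = i , v , chased , record { free = free ; gap = gap ; closest = closest }
      where
      chased : chase c y ≡ just (i , v)
      chased rewrite eqᵢ | eqᵥ = refl
      closest : ∀ {j v'} → Free c y j → Unoccupied c y v' → dist v (c i) ≤ dist v' (c j)
      closest {j} free-j gap' =
        ≤-trans (≤-reflexive (sym (cong (maybe′ (λ v → dist v (c i)) 0) eqᵥ)))
                (≤-trans (closest-cop j free-j) (gap-distance-≤ j gap'))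

  -- The default 0 never matters: chase succeeds as long as the robber is free.
  pursuit-distance : Cops → Node → ℕ
  pursuit-distance c y = maybe′ (λ (i , v) → dist v (c i)) 0 (chase c y)

  pursuit-wait : ℕ → Cops → Node → ℕ
  pursuit-wait t c y = maybe′ (λ (i , v) → next-appearance t (c i) (towards v (c i))) 0 (chase c y)

  pursuit-distance-≤ : ∀ {c y i v} → Free c y i → Unoccupied c y v →
                       pursuit-distance c y ≤ dist v (c i)
  pursuit-distance-≤ free gap with chase-pursues gap
  ... | _ , _ , eq , pursuit rewrite eq = Pursuit.closest pursuit free gap

  pursuit-distance-chased : ∀ {c y i v} → chase c y ≡ just (i , v) → pursuit-distance c y ≡ dist v (c i)
  pursuit-distance-chased {c} = cong (maybe′ (λ (j , u) → dist u (c j)) 0)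

  gap-is-away : ∀ {c y v} i → Unoccupied c y v → ∃[ m ] dist v (c i) ≡ suc m
  gap-is-away {c} {v = v} i (_ , ¬occ) with dist v (c i) in eq
  ... | zero = ⊥-elim (¬occ (i , dist≡0⇒≡ eq))
  ... | suc m = m , refl

  _[_]≔_ : Cops → Fin (suc w) → Fin n → Cops
  c [ i ]≔ u = updateAt c i (const u)

  step-towards : ℕ → Cops → Fin (suc w) → Fin n → Cops
  step-towards t c i v with edgeAt? (c i) (towards v (c i)) t
  ... | yes _ = c [ i ]≔ towards v (c i)
  ... | no _ = c

  cops-move : ℕ → Cops → Fin n → Cops
  cops-move t c r with occupied? c r
  ... | yes _ = c
  ... | no _ = maybe′ (λ (i , v) → step-towards t c i v) c (chase c (target c r))

  step-towards-legal : ∀ t c i v j → Edge (at t) (c j) (step-towards t c i v j)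
  step-towards-legal t c i v j with edgeAt? (c i) (towards v (c i)) t
  ... | no _ = Graph.adj-refl (at t) (c j)
  ... | yes now with j ≟ᶠ i
  ...   | yes refl = subst (Edge (at t) (c i)) (sym (updateAt-updates i c)) now
  ...   | no j≢i =
    subst (Edge (at t) (c j)) (sym (updateAt-minimal j i c j≢i)) (Graph.adj-refl (at t) (c j))

  cops-move-legal : ∀ t c r j → Edge (at t) (c j) (cops-move t c r j)
  cops-move-legal t c r j with occupied? c r
  ... | yes _ = Graph.adj-refl (at t) (c j)
  ... | no _ with chase c (target c r)
  ...   | nothing = Graph.adj-refl (at t) (c j)
  ...   | just (i , v) = step-towards-legal t c i v j

  cops-move-stays : ∀ t {c r} → Occupied c r → Occupied (cops-move t c r) r
  cops-move-stays t {c} {r} occ with occupied? c r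
  ... | yes _ = occ
  ... | no ¬occ = ⊥-elim (¬occ occ)

  cops-move-chases : ∀ t {c r i v} → ¬ Occupied c r → chase c (target c r) ≡ just (i , v) →
                     cops-move t c r ≡ step-towards t c i v
  cops-move-chases t {c} {r} ¬occ eq with occupied? c r
  ... | yes occ = ⊥-elim (¬occ occ)
  ... | no _ rewrite eq = refl

  potential : ℕ → Cops → Node → ℕ⁴
  potential t c y = nodes-after y , ∣ ⟦ unoccupied? c y ⟧ ∣ , pursuit-distance c y , pursuit-wait t c y

  measure : ℕ → Cops → Fin n → ℕ⁴
  measure t c r = potential t c (target c r)

  Progress : ℕ → Cops → Fin n → Cops → Fin n → Set
  Progress t c r c' r' = Occupied c' r' ⊎ measure (suc t) c' r' <ₗₑₓ measure t c r

  confined-progress : ∀ t {c c' r r'} → Edge G r r' →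
                      (∀ {x} → x ∈ bag (target c r) → Occupied c x → Occupied c' x) →
                      potential (suc t) c' (target c r) <ₗₑₓ potential t c (target c r) →
                      Progress t c r c' r'
  confined-progress t {c} {c'} {r} {r'} e keeps shorter
    with confinement-persists (proj₁ (target-deepest c r)) keeps e
  ... | inj₁ occ = inj₁ occ
  ... | inj₂ confined with m≤n⇒m<n∨m≡n (proj₂ (target-deepest c' r') _ confined)
  ...   | inj₁ deeper = inj₂ (inj₁ deeper)
  ...   | inj₂ same =
    inj₂ (subst (λ y → potential (suc t) c' y <ₗₑₓ measure t c r) (sym (nodes-after-injective same)) shorter)

  wait-shortens : ∀ t {c y i v} → chase c y ≡ just (i , v) → Edge G (c i) (towards v (c i)) →
                  ¬ EdgeAt (c i) (towards v (c i)) t → potential (suc t) c y <ₗₑₓ potential t c y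
  wait-shortens t eq e ¬now rewrite eq =
    let _ , e-snap = proj₁ (footprint _ _) e
    in inj₂ (refl , inj₂ (refl , inj₂ (refl , next-appearance-suc t e-snap ¬now)))

  module Moving {c y i v} (pursuit : Pursuit c y i v) where
    open Pursuit pursuit

    u' : Fin n
    u' = towards v (c i)

    c' : Cops
    c' = c [ i ]≔ u'

    keeps-occupied : ∀ {x} → x ∈ bag y → Occupied c x → Occupied c' x
    keeps-occupied {x} x∈y (j , cj≡x) with j ≟ᶠ i | free
    ... | no j≢i | _ = j , trans (updateAt-minimal j i c j≢i) cj≡x
    ... | yes refl | inj₁ ci∉y = ⊥-elim (ci∉y (subst (_∈ bag y) (sym cj≡x) x∈y))
    ... | yes refl | inj₂ (l , l≢i , cl≡ci) =
      l , trans (updateAt-minimal l i c l≢i) (trans cl≡ci cj≡x)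

    unoccupied-before : ∀ {x} → Unoccupied c' y x → Unoccupied c y x
    unoccupied-before (x∈y , ¬occ') = x∈y , ¬occ' ∘ keeps-occupied x∈y

    fills-gap : Unoccupied c y u' → ∣ ⟦ unoccupied? c' y ⟧ ∣ < ∣ ⟦ unoccupied? c y ⟧ ∣
    fills-gap gap' = ∣⟦⟧∣-< (unoccupied? c' y) (unoccupied? c y) unoccupied-before gap'
                            (λ (_ , ¬occ') → ¬occ' (i , updateAt-updates i c))

    module _ (¬gap' : ¬ Unoccupied c y u') where

      unoccupied-after : ∀ {x} → Unoccupied c y x → Unoccupied c' y x
      unoccupied-after {x} (x∈y , ¬occ) = x∈y , λ (j , c'j≡x) → vacant j c'j≡x
        where
        vacant : ∀ j → c' j ≢ x
        vacant j c'j≡x with j ≟ᶠ i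
        ... | yes refl =
          ¬gap' (subst (Unoccupied c y) (trans (sym c'j≡x) (updateAt-updates i c)) (x∈y , ¬occ))
        ... | no j≢i = ¬occ (j , trans (sym (updateAt-minimal j i c j≢i)) c'j≡x)

      still-free : c i ≢ u' → Free c' y i
      still-free ci≢u' with u' ∈? bag y
      ... | no u'∉y = inj₁ (subst (_∉ bag y) (sym (updateAt-updates i c)) u'∉y)
      ... | yes u'∈y with decidable-stable (occupied? c u') (λ ¬occ → ¬gap' (u'∈y , ¬occ))
      ...   | j , cj≡u' =
        inj₂ (j , j≢i , trans (updateAt-minimal j i c j≢i) (trans cj≡u' (sym (updateAt-updates i c))))
        where
        j≢i : j ≢ i
        j≢i refl = ci≢u' cj≡u'

    shortens : ∀ t {m} → chase c y ≡ just (i , v) → dist v (c i) ≡ suc m →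
               potential (suc t) c' y <ₗₑₓ potential t c y
    shortens t {m} eq d≡ with unoccupied? c y u'
    ... | yes gap' = inj₂ (refl , inj₁ (fills-gap gap'))
    ... | no ¬gap' = inj₂ (refl , inj₂ (same-gaps , inj₁ closer))
      where
      same-gaps : ∣ ⟦ unoccupied? c' y ⟧ ∣ ≡ ∣ ⟦ unoccupied? c y ⟧ ∣
      same-gaps =
        cong ∣_∣ (⟦⟧-cong (unoccupied? c' y) (unoccupied? c y) unoccupied-before (unoccupied-after ¬gap'))
      moved : c i ≢ u'
      moved ci≡u' =
        <-irrefl refl (subst (_≤ m) (trans (cong (dist v) (sym ci≡u')) d≡) (proj₂ (towards-closer d≡)))
      open ≤-Reasoning
      closer : pursuit-distance c' y < pursuit-distance c y
      closer = begin-strict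
        pursuit-distance c' y ≤⟨ pursuit-distance-≤ (still-free ¬gap' moved) (unoccupied-after ¬gap' gap) ⟩
        dist v (c' i)         ≡⟨ cong (dist v) (updateAt-updates i c) ⟩
        dist v u'             ≤⟨ proj₂ (towards-closer d≡) ⟩
        m                     <⟨ n<1+n m ⟩
        suc m                 ≡⟨ sym d≡ ⟩
        dist v (c i)          ≡⟨ sym (pursuit-distance-chased eq) ⟩
        pursuit-distance c y  ∎

  pursue : ∀ t {c r r' i v} → Edge G r r' →
           chase c (target c r) ≡ just (i , v) → Pursuit c (target c r) i v →
           Progress t c r (step-towards t c i v) r'
  pursue t {c} {i = i} {v} e eq pursuit with gap-is-away i (Pursuit.gap pursuit)
  ... | m , d≡ with edgeAt? (c i) (towards v (c i)) t
  ...   | yes _ =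
    confined-progress t e (Moving.keeps-occupied pursuit) (Moving.shortens pursuit t eq d≡)
  ...   | no ¬now =
    confined-progress t e (λ _ occ → occ) (wait-shortens t eq (proj₁ (towards-closer d≡)) ¬now)

  progress : ∀ t {c r r'} → ¬ Occupied c r → Edge (at t) r r' → Progress t c r (cops-move t c r) r'
  progress t ¬occ e with chase-pursues (proj₂ (target-has-gap ¬occ))
  ... | i , v , eq , pursuit rewrite cops-move-chases t ¬occ eq = pursue t (footprint-edge {t} e) eq pursuit

  chase-strategy : Fin n → CopStrategy 𝒢 (suc w)
  chase-strategy v₀ = record
    { start = const v₀
    ; move  = λ t _ c r → cops-move t c r , cops-move-legal t c r
    }

  chase-wins : Fin n → CopsWin 𝒢 (suc w)
  chase-wins v₀ = chase-strategy v₀ ,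
    wins-by-descent (chase-strategy v₀) <ₗₑₓ-wellFounded measure
                    (λ t _ _ _ → cops-move-stays t) (λ t _ _ _ _ → progress t)

cops-win-without-vertices : (𝒢 : PeriodicGraph 0) → CopsWin 𝒢 0
cops-win-without-vertices 𝒢 =
  record { start = λ () ; move = λ _ _ _ () } , λ ρ → ⊥-elim (¬Fin0 (RobberStrategy.start ρ λ ()))

theorem3 : (n : ℕ) (G : Graph n) → Connected G →
           (D : TreeDecomposition G) (w : ℕ) → WidthAtMost D w →
           (𝒢 : PeriodicGraph n) → HasFootprint 𝒢 G →
           CopNumber≤ 𝒢 (suc w)
theorem3 zero G connected D w narrow 𝒢 footprint = 0 , z≤n , cops-win-without-vertices 𝒢
theorem3 (suc n) G connected D w narrow 𝒢 footprint =
  suc w , ≤-refl , Chase.chase-wins G connected D w narrow 𝒢 footprint fzero
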